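{- If a sequent $\sigma$ is a theorem of $\mathrm{PL}+{\to}\mathrm{ED}$, then $V(\sigma)=\top$ for every valuation $V$.
   Context: Formulas are built from propositional variables and constants $\top,\bot$ using $\land$ and $\to$; a sequent is $\Gamma\vdash\phi$ with $\Gamma$ a finite list of formulas. $\mathrm{PL}$ has the rules: $\vdash\top$; $\phi\vdash\phi$; from $\Gamma\vdash\psi$ infer $\Gamma,\phi\vdash\psi$; from $\Gamma\vdash\phi$ and $\Gamma,\phi\vdash\psi$ infer $\Gamma\vdash\psi$; from $\Gamma\vdash\phi\land\psi$ infer $\Gamma\vdash\phi$ and $\Gamma\vdash\psi$; from $\Gamma\vdash\phi$ and $\Gamma\vdash\psi$ infer $\Gamma\vdash\phi\land\psi$; from $\Gamma\vdash\phi$ and $\Gamma\vdash\phi\to\psi$ infer $\Gamma\vdash\psi$; from $\Gamma\vdash\psi$ infer $\Gamma\vdash\phi\to\psi$. $\mathrm{PL}+{\to}\mathrm{ED}$ is $\mathrm{PL}$ plus the rule (${\to}$ED): from $\Gamma\vdash\phi\to\psi$ infer $\Gamma\vdash\psi$. A valuation is a function $V$ from the set of all sequents to $\{\top,\bot\}$ such that: $V(\vdash\top)=\top$; $V(\vdash\phi\land\psi)=\top$ iff $V(\vdash\phi)=V(\vdash\psi)=\top$; $V(\vdash\phi\to\psi)=V(\vdash\psi)$; and $V(\Gamma\vdash\phi)=\top$ iff $V(\vdash\gamma)=\bot$ for some $\gamma$ in $\Gamma$ or $V(\vdash\phi)=\top$. -}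

module Defs where

open import Data.Nat using (ℕ)
open import Data.List using (List; []; _∷_; _++_; [_])
open import Data.List.Membership.Propositional using (_∈_)
open import Data.Bool using (Bool; true; false)
open import Data.Product using (Σ; _×_; ∃-syntax)
open import Data.Sum using (_⊎_)
open import Relation.Binary.PropositionalEquality using (_≡_)
open import Function.Bundles using (_⇔_)

data Formula : Set where
  var  : ℕ → Formula
  ⊤'   : Formula
  ⊥'   : Formula
  _∧'_ : Formula → Formula → Formula
  _⇒_  : Formula → Formula → Formula

infixr 6 _∧'_
infixr 5 _⇒_
infix 4 _⊢_

record Sequent : Set where
  constructor _⊢_
  field
    ctx  : List Formula
    goal : Formula

_,,_ : List Formula → Formula → List Formula
Γ ,, φ = Γ ++ [ φ ]

data Thm : Sequent → Set where
  ⊤-ax  : Thm ([] ⊢ ⊤')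
  id-ax : ∀ φ → Thm ([ φ ] ⊢ φ)
  weak  : ∀ {Γ φ ψ} → Thm (Γ ⊢ ψ) → Thm ((Γ ,, φ) ⊢ ψ)
  cut   : ∀ {Γ φ ψ} → Thm (Γ ⊢ φ) → Thm ((Γ ,, φ) ⊢ ψ) → Thm (Γ ⊢ ψ)
  ∧E₁   : ∀ {Γ φ ψ} → Thm (Γ ⊢ φ ∧' ψ) → Thm (Γ ⊢ φ)
  ∧E₂   : ∀ {Γ φ ψ} → Thm (Γ ⊢ φ ∧' ψ) → Thm (Γ ⊢ ψ)
  ∧I    : ∀ {Γ φ ψ} → Thm (Γ ⊢ φ) → Thm (Γ ⊢ ψ) → Thm (Γ ⊢ φ ∧' ψ)
  ⇒E    : ∀ {Γ φ ψ} → Thm (Γ ⊢ φ) → Thm (Γ ⊢ φ ⇒ ψ) → Thm (Γ ⊢ ψ)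
  ⇒I    : ∀ {Γ φ ψ} → Thm (Γ ⊢ ψ) → Thm (Γ ⊢ φ ⇒ ψ)
  ⇒ED   : ∀ {Γ φ ψ} → Thm (Γ ⊢ φ ⇒ ψ) → Thm (Γ ⊢ ψ)

record Valuation : Set where
  field
    V      : Sequent → Bool
    V-⊤    : V ([] ⊢ ⊤') ≡ true
    V-∧    : ∀ φ ψ → (V ([] ⊢ φ ∧' ψ) ≡ true) ⇔ (V ([] ⊢ φ) ≡ true × V ([] ⊢ ψ) ≡ true)
    V-⇒    : ∀ φ ψ → V ([] ⊢ φ ⇒ ψ) ≡ V ([] ⊢ ψ)
    V-seq  : ∀ Γ φ → (V (Γ ⊢ φ) ≡ true) ⇔
               ((∃[ γ ] (γ ∈ Γ × V ([] ⊢ γ) ≡ false)) ⊎ V ([] ⊢ φ) ≡ true)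

-- Each rule of PL + (→ED) preserves the clause of a valuation for sequents: Γ ⊢ φ
-- is true iff some premise is false or φ is true.  Since V(φ ⇒ ψ) = V(ψ), the
-- implication rules, including (→ED), merely transport truth between φ ⇒ ψ and ψ.
module Submission where

open import Defs
open import Data.Bool using (true; false)
open import Data.List using (List; []; [_])
open import Data.List.Membership.Propositional using (_∈_)
open import Data.List.Membership.Propositional.Properties using (∈-++⁺ˡ; ∈-++⁻)
open import Data.List.Relation.Unary.Any using (here)
open import Data.Product using (_×_; _,_; proj₁; proj₂; ∃-syntax)
open import Data.Sum using (_⊎_; inj₁; inj₂; map₂)
open import Function.Bundles using (Equivalence)
open import Relation.Binary.PropositionalEquality using (_≡_; refl; trans; sym)

module Semantics (v : Valuation) where
  open Valuation v

  True : Formula → Set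
  True φ = V ([] ⊢ φ) ≡ true

  Refuted : List Formula → Set
  Refuted Γ = ∃[ γ ] (γ ∈ Γ × V ([] ⊢ γ) ≡ false)

  infix 4 _⊨_
  _⊨_ : List Formula → Formula → Set
  Γ ⊨ φ = Refuted Γ ⊎ True φ

  ⊨-map : ∀ {Γ φ ψ} → (True φ → True ψ) → Γ ⊨ φ → Γ ⊨ ψ
  ⊨-map = map₂

  ⊨-zip : ∀ {Γ φ ψ χ} → (True φ → True ψ → True χ) → Γ ⊨ φ → Γ ⊨ ψ → Γ ⊨ χ
  ⊨-zip f (inj₁ r) _        = inj₁ r
  ⊨-zip f (inj₂ _) (inj₁ r) = inj₁ r
  ⊨-zip f (inj₂ a) (inj₂ b) = inj₂ (f a b)

  ⊨-id : ∀ φ → [ φ ] ⊨ φ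
  ⊨-id φ with V ([] ⊢ φ) in eq
  ... | true  = inj₂ refl
  ... | false = inj₁ (φ , here refl , eq)

  ⊨-weaken : ∀ {Γ φ ψ} → Γ ⊨ ψ → Γ ,, φ ⊨ ψ
  ⊨-weaken (inj₁ (γ , γ∈Γ , γ-false)) = inj₁ (γ , ∈-++⁺ˡ γ∈Γ , γ-false)
  ⊨-weaken (inj₂ ψ-true)              = inj₂ ψ-true

  ⊨-cut : ∀ {Γ φ ψ} → Γ ⊨ φ → Γ ,, φ ⊨ ψ → Γ ⊨ ψ
  ⊨-cut         (inj₁ r)      _        = inj₁ r
  ⊨-cut         (inj₂ _)      (inj₂ b) = inj₂ b
  ⊨-cut {Γ = Γ} (inj₂ φ-true) (inj₁ (γ , γ∈Γ,,φ , γ-false)) with ∈-++⁻ Γ γ∈Γ,,φ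
  ... | inj₁ γ∈Γ         = inj₁ (γ , γ∈Γ , γ-false)
  ... | inj₂ (here refl) with () ← trans (sym φ-true) γ-false

  sound : ∀ {Γ φ} → Thm (Γ ⊢ φ) → Γ ⊨ φ
  sound ⊤-ax      = inj₂ V-⊤
  sound (id-ax φ) = ⊨-id φ
  sound (weak d)  = ⊨-weaken (sound d)
  sound (cut d e) = ⊨-cut (sound d) (sound e)
  sound (∧E₁ d)   = ⊨-map (λ t → proj₁ (Equivalence.to (V-∧ _ _) t)) (sound d)
  sound (∧E₂ d)   = ⊨-map (λ t → proj₂ (Equivalence.to (V-∧ _ _) t)) (sound d)
  sound (∧I d e)  = ⊨-zip (λ a b → Equivalence.from (V-∧ _ _) (a , b)) (sound d) (sound e)
  sound (⇒E _ e)  = ⊨-map (trans (sym (V-⇒ _ _))) (sound e)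
  sound (⇒I d)    = ⊨-map (trans (V-⇒ _ _)) (sound d)
  sound (⇒ED d)   = ⊨-map (trans (sym (V-⇒ _ _))) (sound d)

lemma4p1 : ∀ (σ : Sequent) → Thm σ → ∀ (v : Valuation) → Valuation.V v σ ≡ true
lemma4p1 (Γ ⊢ φ) d v = Equivalence.from (V-seq Γ φ) (sound d)
  where
    open Valuation v
    open Semantics v
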